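{- For every $n\in\mathbb{N}$, every formula of $\mathrm{FO}[2n]$ is equivalent to a formula of $\mathrm{FO}_n$, and every formula of $\mathrm{MSO}[2n]$ is equivalent to a formula of $\mathrm{MSO}_n$.
   Context: FO and MSO formulas are over the vocabulary $\{<,P_l,P_r\}$ of word models of words over $\Sigma=\{l,r\}$. Size: $\mathrm{sz}(\phi)=1$ for atomic $\phi$; $\mathrm{sz}(\psi\wedge\theta)=\mathrm{sz}(\psi\vee\theta)=\mathrm{sz}(\psi)+\mathrm{sz}(\theta)+1$; $\mathrm{sz}(\neg\psi)$ and $\mathrm{sz}$ of $\exists x\psi,\forall x\psi,\exists U\psi,\forall U\psi$ equal $\mathrm{sz}(\psi)+1$. $\mathrm{FO}[m]$ (resp. $\mathrm{MSO}[m]$) is the set of formulas of size at most $m$. Quantifier rank: $0$ for atomic formulas, unchanged by $\neg$, maximum over $\wedge,\vee$, each quantifier adds $1$; $\mathrm{FO}_n$ (resp. $\mathrm{MSO}_n$) is the set of formulas of quantifier rank at most $n$. -}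

module Defs where

open import Data.Nat using (ℕ; zero; suc; _+_; _⊔_)
open import Data.Bool using (Bool; true; false; not; _∧_; _∨_)
open import Data.Fin using (Fin; _<?_; _≟_)
open import Data.List using (List; []; _∷_; length; lookup; map; _++_; allFin)
open import Data.Bool.ListAction using (any; all)
open import Data.Vec using (Vec) renaming ([] to []ᵥ; _∷_ to _∷ᵥ_)
import Data.Vec as Vec
open import Data.Vec.Functional using () renaming (_∷_ to _∷ᶠ_)
open import Data.Fin.Subset using (Subset)
open import Relation.Nullary.Decidable using (⌊_⌋)
open import Relation.Binary.PropositionalEquality using (_≡_)

data Σ : Set where
  l r : Σ

Word : Set
Word = List Σ

data Logic : Set where
  fo mso : Logic

-- Formulas over {<, P_l, P_r} (plus equality), in a context of
-- k free first-order and j free set variables (de Bruijn indices).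
-- Set quantifiers and membership atoms exist only in MSO.
data Form : Logic → ℕ → ℕ → Set where
  lt   : ∀ {L k j} → Fin k → Fin k → Form L k j
  eq   : ∀ {L k j} → Fin k → Fin k → Form L k j
  Pl   : ∀ {L k j} → Fin k → Form L k j
  Pr   : ∀ {L k j} → Fin k → Form L k j
  mem  : ∀ {k j} → Fin j → Fin k → Form mso k j
  neg  : ∀ {L k j} → Form L k j → Form L k j
  conj : ∀ {L k j} → Form L k j → Form L k j → Form L k j
  disj : ∀ {L k j} → Form L k j → Form L k j → Form L k j
  ex   : ∀ {L k j} → Form L (suc k) j → Form L k j
  all′ : ∀ {L k j} → Form L (suc k) j → Form L k j
  exS  : ∀ {k j} → Form mso k (suc j) → Form mso k j
  allS : ∀ {k j} → Form mso k (suc j) → Form mso k j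

sz : ∀ {L k j} → Form L k j → ℕ
sz (lt x y) = 1
sz (eq x y) = 1
sz (Pl x) = 1
sz (Pr x) = 1
sz (mem U x) = 1
sz (neg φ) = suc (sz φ)
sz (conj φ ψ) = sz φ + sz ψ + 1
sz (disj φ ψ) = sz φ + sz ψ + 1
sz (ex φ) = suc (sz φ)
sz (all′ φ) = suc (sz φ)
sz (exS φ) = suc (sz φ)
sz (allS φ) = suc (sz φ)

qr : ∀ {L k j} → Form L k j → ℕ
qr (lt x y) = 0
qr (eq x y) = 0
qr (Pl x) = 0
qr (Pr x) = 0
qr (mem U x) = 0
qr (neg φ) = qr φ
qr (conj φ ψ) = qr φ ⊔ qr ψ
qr (disj φ ψ) = qr φ ⊔ qr ψ
qr (ex φ) = suc (qr φ)
qr (all′ φ) = suc (qr φ)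
qr (exS φ) = suc (qr φ)
qr (allS φ) = suc (qr φ)

subsets : (n : ℕ) → List (Subset n)
subsets zero = []ᵥ ∷ []
subsets (suc n) = map (true ∷ᵥ_) (subsets n) ++ map (false ∷ᵥ_) (subsets n)

isL isR : Σ → Bool
isL l = true
isL r = false
isR l = false
isR r = true

eval : ∀ {L k j} → Form L k j → (w : Word) →
       (Fin k → Fin (length w)) → (Fin j → Subset (length w)) → Bool
eval (lt x y) w ρ σ = ⌊ ρ x <? ρ y ⌋
eval (eq x y) w ρ σ = ⌊ ρ x ≟ ρ y ⌋
eval (Pl x) w ρ σ = isL (lookup w (ρ x))
eval (Pr x) w ρ σ = isR (lookup w (ρ x))
eval (mem U x) w ρ σ = Vec.lookup (σ U) (ρ x)
eval (neg φ) w ρ σ = not (eval φ w ρ σ)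
eval (conj φ ψ) w ρ σ = eval φ w ρ σ ∧ eval ψ w ρ σ
eval (disj φ ψ) w ρ σ = eval φ w ρ σ ∨ eval ψ w ρ σ
eval (ex φ) w ρ σ = any (λ p → eval φ w (p ∷ᶠ ρ) σ) (allFin (length w))
eval (all′ φ) w ρ σ = all (λ p → eval φ w (p ∷ᶠ ρ) σ) (allFin (length w))
eval (exS φ) w ρ σ = any (λ U → eval φ w ρ (U ∷ᶠ σ)) (subsets (length w))
eval (allS φ) w ρ σ = all (λ U → eval φ w ρ (U ∷ᶠ σ)) (subsets (length w))

_≅_ : ∀ {L L′ k j} → Form L k j → Form L′ k j → Set
φ ≅ ψ = ∀ w ρ σ → eval φ w ρ σ ≡ eval ψ w ρ σ

-- Prune vacuous quantifiers: drop them, except that a vacuous first-order quantifier with no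
-- free first-order variable in scope becomes a test that the word is nonempty. The pruned
-- formula ψ of φ satisfies 2·qr ψ + #(free variable occurrences in ψ) ≤ sz φ + 1, so sz φ ≤ 2n
-- forces qr ψ ≤ n. A remaining quantifier adds 2 to the left side but binds at least one
-- occurrence; atoms have at most two occurrences; a binary connective adds 1 to the size
-- while the maximum of the ranks is at most their sum.
module Submission where

open import Defs
open import Data.Nat using (ℕ; _≤_; _*_)
open import Data.Product using (Σ-syntax; _×_)

open import Algebra.Properties.CommutativeSemigroup using (interchange)
open import Data.Bool using (Bool; true; false; not; _∧_; _∨_)
open import Data.Bool.ListAction using (any; all; or; and)
open import Data.Nat.Tactic.RingSolver using (solve-∀)
open import Data.Bool.Properties using (∧-identityʳ; ∧-zeroʳ)
open import Data.Fin using (Fin; _<?_; _≟_) renaming (zero to fz; suc to fs)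
open import Data.Fin.Subset using (Subset)
open import Data.List using (List; []; _∷_; length; allFin; null; lookup)
open import Data.List.Properties using (map-cong)
open import Data.Nat using (zero; suc; _+_; _⊔_; _<_; z≤n; s≤s; s≤s⁻¹)
import Data.Nat as ℕ
open import Data.Nat.Properties
  using ( ≤-refl; ≤-trans; n≤1+n; n<1+n; m≤n⇒m≤1+n; m≤m+n; m≤m⊔n; m⊔n≤m+n; m≥n⇒m⊔n≡m
        ; m+n≡0⇒m≡0; m+n≡0⇒n≡0; +-identityʳ; +-mono-≤; +-monoʳ-≤; +-monoˡ-≤; *-monoʳ-≤
        ; +-suc; +-comm; *-suc; *-cancelˡ-<; +-commutativeSemigroup; module ≤-Reasoning)
open import Data.Product using (_,_)
import Data.Vec as Vec
open import Data.Vec.Functional using () renaming (_∷_ to _∷ᶠ_)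
open import Function using (const)
open import Relation.Nullary using (yes; no; contradiction)
open import Relation.Nullary.Decidable using (⌊_⌋)
open import Relation.Binary.PropositionalEquality
  using (_≡_; _≢_; refl; sym; trans; cong; cong₂; subst; ≡-≟-identity; module ≡-Reasoning)

private variable
  A : Set
  L : Logic
  k j k′ j′ n s : ℕ

any-cong : {f g : A → Bool} (xs : List A) → (∀ x → f x ≡ g x) → any f xs ≡ any g xs
any-cong xs f≗g = cong or (map-cong f≗g xs)

all-cong : {f g : A → Bool} (xs : List A) → (∀ x → f x ≡ g x) → all f xs ≡ all g xs
all-cong xs f≗g = cong and (map-cong f≗g xs)

all≡not-any-not : (f : A → Bool) (xs : List A) → all f xs ≡ not (any (λ x → not (f x)) xs)
all≡not-any-not f [] = refl
all≡not-any-not f (x ∷ xs) with f x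
... | true  = all≡not-any-not f xs
... | false = refl

any-const : (b : Bool) (xs : List A) → any (const b) xs ≡ b ∧ not (null xs)
any-const b     []       = sym (∧-zeroʳ b)
any-const true  (_ ∷ _)  = refl
any-const false (_ ∷ xs) = any-const false xs

any-const-nonnull : (b : Bool) {xs : List A} → null xs ≡ false → any (const b) xs ≡ b
any-const-nonnull b {xs} xs≢[] = trans (any-const b xs) (trans (cong (λ z → b ∧ not z) xs≢[]) (∧-identityʳ b))

allFin-nonnull : Fin n → null (allFin n) ≡ false
allFin-nonnull {suc n} _ = refl

subsets-nonnull : ∀ n → null (subsets n) ≡ false
subsets-nonnull zero = refl
subsets-nonnull (suc n) with subsets n | subsets-nonnull n
... | _ ∷ _ | _ = refl

occ : Form L k j → (Fin k → ℕ) → (Fin j → ℕ) → ℕ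
occ (lt x y)   c d = c x + c y
occ (eq x y)   c d = c x + c y
occ (Pl x)     c d = c x
occ (Pr x)     c d = c x
occ (mem U x)  c d = d U + c x
occ (neg φ)    c d = occ φ c d
occ (conj φ ψ) c d = occ φ c d + occ ψ c d
occ (disj φ ψ) c d = occ φ c d + occ ψ c d
occ (ex φ)     c d = occ φ (0 ∷ᶠ c) d
occ (all′ φ)   c d = occ φ (0 ∷ᶠ c) d
occ (exS φ)    c d = occ φ c (0 ∷ᶠ d)
occ (allS φ)   c d = occ φ c (0 ∷ᶠ d)

freeOcc : Form L k j → ℕ
freeOcc φ = occ φ (const 1) (const 1)

Splits : (Fin n → ℕ) → (Fin n → ℕ) → (Fin n → ℕ) → Set
Splits c c₁ c₂ = ∀ i → c i ≡ c₁ i + c₂ i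

∷-splits : {c c₁ c₂ : Fin n → ℕ} → Splits c c₁ c₂ → Splits (0 ∷ᶠ c) (0 ∷ᶠ c₁) (0 ∷ᶠ c₂)
∷-splits h fz     = refl
∷-splits h (fs i) = h i

+-split : ∀ a₁ a₂ b₁ b₂ {a b} → a ≡ a₁ + a₂ → b ≡ b₁ + b₂ → a + b ≡ (a₁ + b₁) + (a₂ + b₂)
+-split a₁ a₂ b₁ b₂ refl refl = interchange +-commutativeSemigroup a₁ a₂ b₁ b₂

occ-linear : (φ : Form L k j) (c₁ c₂ : Fin k → ℕ) (d₁ d₂ : Fin j → ℕ) {c : Fin k → ℕ} {d : Fin j → ℕ} →
             Splits c c₁ c₂ → Splits d d₁ d₂ → occ φ c d ≡ occ φ c₁ d₁ + occ φ c₂ d₂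
occ-linear (lt x y)   c₁ c₂ d₁ d₂ hc hd = +-split (c₁ x) (c₂ x) (c₁ y) (c₂ y) (hc x) (hc y)
occ-linear (eq x y)   c₁ c₂ d₁ d₂ hc hd = +-split (c₁ x) (c₂ x) (c₁ y) (c₂ y) (hc x) (hc y)
occ-linear (Pl x)     c₁ c₂ d₁ d₂ hc hd = hc x
occ-linear (Pr x)     c₁ c₂ d₁ d₂ hc hd = hc x
occ-linear (mem U x)  c₁ c₂ d₁ d₂ hc hd = +-split (d₁ U) (d₂ U) (c₁ x) (c₂ x) (hd U) (hc x)
occ-linear (neg φ)    c₁ c₂ d₁ d₂ hc hd = occ-linear φ c₁ c₂ d₁ d₂ hc hd
occ-linear (conj φ ψ) c₁ c₂ d₁ d₂ hc hd =
  +-split (occ φ c₁ d₁) (occ φ c₂ d₂) (occ ψ c₁ d₁) (occ ψ c₂ d₂)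
    (occ-linear φ c₁ c₂ d₁ d₂ hc hd) (occ-linear ψ c₁ c₂ d₁ d₂ hc hd)
occ-linear (disj φ ψ) c₁ c₂ d₁ d₂ hc hd =
  +-split (occ φ c₁ d₁) (occ φ c₂ d₂) (occ ψ c₁ d₁) (occ ψ c₂ d₂)
    (occ-linear φ c₁ c₂ d₁ d₂ hc hd) (occ-linear ψ c₁ c₂ d₁ d₂ hc hd)
occ-linear (ex φ)     c₁ c₂ d₁ d₂ hc hd = occ-linear φ (0 ∷ᶠ c₁) (0 ∷ᶠ c₂) d₁ d₂ (∷-splits hc) hd
occ-linear (all′ φ)   c₁ c₂ d₁ d₂ hc hd = occ-linear φ (0 ∷ᶠ c₁) (0 ∷ᶠ c₂) d₁ d₂ (∷-splits hc) hd
occ-linear (exS φ)    c₁ c₂ d₁ d₂ hc hd = occ-linear φ c₁ c₂ (0 ∷ᶠ d₁) (0 ∷ᶠ d₂) hc (∷-splits hd)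
occ-linear (allS φ)   c₁ c₂ d₁ d₂ hc hd = occ-linear φ c₁ c₂ (0 ∷ᶠ d₁) (0 ∷ᶠ d₂) hc (∷-splits hd)

Ren₀ : (Fin k → ℕ) → ℕ → Set
Ren₀ {k} c k′ = (i : Fin k) → c i ≡ 0 → Fin k′

lift₀ : {c : Fin k → ℕ} → Ren₀ c k′ → Ren₀ (0 ∷ᶠ c) (suc k′)
lift₀ f fz     _ = fz
lift₀ f (fs i) p = fs (f i p)

Agree : {c : Fin k → ℕ} → Ren₀ c k′ → (Fin k′ → A) → (Fin k → A) → Set
Agree f ρ ρ′ = ∀ i p → ρ (f i p) ≡ ρ′ i

lift₀-agree : {c : Fin k → ℕ} {f : Ren₀ c k′} {ρ : Fin k′ → A} {ρ′ : Fin k → A} (x : A) →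
              Agree f ρ ρ′ → Agree (lift₀ f) (x ∷ᶠ ρ) (x ∷ᶠ ρ′)
lift₀-agree x h fz     _ = refl
lift₀-agree x h (fs i) p = h i p

rename : (φ : Form L k j) {c : Fin k → ℕ} {d : Fin j → ℕ} → occ φ c d ≡ 0 →
         Ren₀ c k′ → Ren₀ d j′ → Form L k′ j′
rename (lt x y)   e f g = lt (f x (m+n≡0⇒m≡0 _ e)) (f y (m+n≡0⇒n≡0 _ e))
rename (eq x y)   e f g = eq (f x (m+n≡0⇒m≡0 _ e)) (f y (m+n≡0⇒n≡0 _ e))
rename (Pl x)     e f g = Pl (f x e)
rename (Pr x)     e f g = Pr (f x e)
rename (mem U x)  e f g = mem (g U (m+n≡0⇒m≡0 _ e)) (f x (m+n≡0⇒n≡0 _ e))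
rename (neg φ)    e f g = neg (rename φ e f g)
rename (conj φ ψ) e f g = conj (rename φ (m+n≡0⇒m≡0 _ e) f g) (rename ψ (m+n≡0⇒n≡0 _ e) f g)
rename (disj φ ψ) e f g = disj (rename φ (m+n≡0⇒m≡0 _ e) f g) (rename ψ (m+n≡0⇒n≡0 _ e) f g)
rename (ex φ)     e f g = ex (rename φ e (lift₀ f) g)
rename (all′ φ)   e f g = all′ (rename φ e (lift₀ f) g)
rename (exS φ)    e f g = exS (rename φ e f (lift₀ g))
rename (allS φ)   e f g = allS (rename φ e f (lift₀ g))

qr-rename : (φ : Form L k j) {c : Fin k → ℕ} {d : Fin j → ℕ} (e : occ φ c d ≡ 0)
            (f : Ren₀ c k′) (g : Ren₀ d j′) → qr (rename φ e f g) ≡ qr φ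
qr-rename (lt x y)   e f g = refl
qr-rename (eq x y)   e f g = refl
qr-rename (Pl x)     e f g = refl
qr-rename (Pr x)     e f g = refl
qr-rename (mem U x)  e f g = refl
qr-rename (neg φ)    e f g = qr-rename φ e f g
qr-rename (conj φ ψ) e f g = cong₂ _⊔_ (qr-rename φ _ f g) (qr-rename ψ _ f g)
qr-rename (disj φ ψ) e f g = cong₂ _⊔_ (qr-rename φ _ f g) (qr-rename ψ _ f g)
qr-rename (ex φ)     e f g = cong suc (qr-rename φ e (lift₀ f) g)
qr-rename (all′ φ)   e f g = cong suc (qr-rename φ e (lift₀ f) g)
qr-rename (exS φ)    e f g = cong suc (qr-rename φ e f (lift₀ g))
qr-rename (allS φ)   e f g = cong suc (qr-rename φ e f (lift₀ g))

occ-rename : (φ : Form L k j) {c : Fin k → ℕ} {d : Fin j → ℕ} (e : occ φ c d ≡ 0)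
             (f : Ren₀ c k′) (g : Ren₀ d j′) {c′ : Fin k′ → ℕ} {d′ : Fin j′ → ℕ} {c″ : Fin k → ℕ} {d″ : Fin j → ℕ} →
             Agree f c′ c″ → Agree g d′ d″ → occ (rename φ e f g) c′ d′ ≡ occ φ c″ d″
occ-rename (lt x y)   e f g hc hd = cong₂ _+_ (hc x _) (hc y _)
occ-rename (eq x y)   e f g hc hd = cong₂ _+_ (hc x _) (hc y _)
occ-rename (Pl x)     e f g hc hd = hc x _
occ-rename (Pr x)     e f g hc hd = hc x _
occ-rename (mem U x)  e f g hc hd = cong₂ _+_ (hd U _) (hc x _)
occ-rename (neg φ)    e f g hc hd = occ-rename φ e f g hc hd
occ-rename (conj φ ψ) e f g hc hd = cong₂ _+_ (occ-rename φ _ f g hc hd) (occ-rename ψ _ f g hc hd)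
occ-rename (disj φ ψ) e f g hc hd = cong₂ _+_ (occ-rename φ _ f g hc hd) (occ-rename ψ _ f g hc hd)
occ-rename (ex φ)     e f g hc hd = occ-rename φ e (lift₀ f) g (lift₀-agree 0 hc) hd
occ-rename (all′ φ)   e f g hc hd = occ-rename φ e (lift₀ f) g (lift₀-agree 0 hc) hd
occ-rename (exS φ)    e f g hc hd = occ-rename φ e f (lift₀ g) hc (lift₀-agree 0 hd)
occ-rename (allS φ)   e f g hc hd = occ-rename φ e f (lift₀ g) hc (lift₀-agree 0 hd)

eval-rename : (φ : Form L k j) {c : Fin k → ℕ} {d : Fin j → ℕ} (e : occ φ c d ≡ 0)
              (f : Ren₀ c k′) (g : Ren₀ d j′) {w : Word}
              {ρ : Fin k′ → Fin (length w)} {σ : Fin j′ → Subset (length w)}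
              {ρ′ : Fin k → Fin (length w)} {σ′ : Fin j → Subset (length w)} →
              Agree f ρ ρ′ → Agree g σ σ′ → eval (rename φ e f g) w ρ σ ≡ eval φ w ρ′ σ′
eval-rename (lt x y)   e f g hρ hσ = cong₂ (λ p q → ⌊ p <? q ⌋) (hρ x _) (hρ y _)
eval-rename (eq x y)   e f g hρ hσ = cong₂ (λ p q → ⌊ p ≟ q ⌋) (hρ x _) (hρ y _)
eval-rename (Pl x)     e f g {w} hρ hσ = cong (λ p → isL (lookup w p)) (hρ x _)
eval-rename (Pr x)     e f g {w} hρ hσ = cong (λ p → isR (lookup w p)) (hρ x _)
eval-rename (mem U x)  e f g hρ hσ = cong₂ Vec.lookup (hσ U _) (hρ x _)
eval-rename (neg φ)    e f g hρ hσ = cong not (eval-rename φ e f g hρ hσ)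
eval-rename (conj φ ψ) e f g hρ hσ = cong₂ _∧_ (eval-rename φ _ f g hρ hσ) (eval-rename ψ _ f g hρ hσ)
eval-rename (disj φ ψ) e f g hρ hσ = cong₂ _∨_ (eval-rename φ _ f g hρ hσ) (eval-rename ψ _ f g hρ hσ)
eval-rename (ex φ)     e f g {w} hρ hσ =
  any-cong (allFin (length w)) λ p → eval-rename φ e (lift₀ f) g (lift₀-agree p hρ) hσ
eval-rename (all′ φ)   e f g {w} hρ hσ =
  all-cong (allFin (length w)) λ p → eval-rename φ e (lift₀ f) g (lift₀-agree p hρ) hσ
eval-rename (exS φ)    e f g {w} hρ hσ =
  any-cong (subsets (length w)) λ U → eval-rename φ e f (lift₀ g) hρ (lift₀-agree U hσ)
eval-rename (allS φ)   e f g {w} hρ hσ =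
  all-cong (subsets (length w)) λ U → eval-rename φ e f (lift₀ g) hρ (lift₀-agree U hσ)

x₀-occ : Form L (suc k) j → ℕ
x₀-occ ψ = occ ψ (1 ∷ᶠ const 0) (const 0)

U₀-occ : Form mso k (suc j) → ℕ
U₀-occ ψ = occ ψ (const 0) (1 ∷ᶠ const 0)

unshift : Ren₀ {suc k} (1 ∷ᶠ const 0) k
unshift fz     ()
unshift (fs i) _ = i

keep : Ren₀ (const 0) k
keep i _ = i

unshift-agree : (x : A) (ρ : Fin k → A) → Agree unshift ρ (x ∷ᶠ ρ)
unshift-agree x ρ fz     ()
unshift-agree x ρ (fs i) _ = refl

keep-agree : (ρ : Fin k → A) → Agree keep ρ ρ
keep-agree ρ i _ = refl

strengthen-x₀ : (ψ : Form L (suc k) j) → x₀-occ ψ ≡ 0 → Form L k j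
strengthen-x₀ ψ e = rename ψ e unshift keep

strengthen-U₀ : (ψ : Form mso k (suc j)) → U₀-occ ψ ≡ 0 → Form mso k j
strengthen-U₀ ψ e = rename ψ e keep unshift

freeOcc-split-x₀ : (ψ : Form L (suc k) j) → freeOcc ψ ≡ occ ψ (0 ∷ᶠ const 1) (const 1) + x₀-occ ψ
freeOcc-split-x₀ ψ = occ-linear ψ _ _ _ _ (λ { fz → refl ; (fs i) → refl }) (λ _ → refl)

freeOcc-split-U₀ : (ψ : Form mso k (suc j)) → freeOcc ψ ≡ occ ψ (const 1) (0 ∷ᶠ const 1) + U₀-occ ψ
freeOcc-split-U₀ ψ = occ-linear ψ _ _ _ _ (λ _ → refl) (λ { fz → refl ; (fs i) → refl })

nonempty : Form L 0 j
nonempty = ex (eq fz fz)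

eval-nonempty : (w : Word) (ρ : Fin 0 → Fin (length w)) (σ : Fin j → Subset (length w)) →
                eval (nonempty {L}) w ρ σ ≡ not (null (allFin (length w)))
eval-nonempty w ρ σ =
  trans (any-cong (allFin (length w)) λ p → cong ⌊_⌋ (≡-≟-identity _≟_ refl)) (any-const true (allFin (length w)))

-- ∃x.φ for x not free in φ: without free first-order variables the word may be empty.
vacuous-ex : (k : ℕ) → Form L k j → Form L k j
vacuous-ex zero    φ = conj φ nonempty
vacuous-ex (suc k) φ = φ

eval-vacuous-ex : (φ : Form L k j) (w : Word) (ρ : Fin k → Fin (length w)) (σ : Fin j → Subset (length w)) →
                  eval (vacuous-ex k φ) w ρ σ ≡ any (const (eval φ w ρ σ)) (allFin (length w))
eval-vacuous-ex {L = L} {k = zero} φ w ρ σ =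
  trans (cong (eval φ w ρ σ ∧_) (eval-nonempty {L = L} w ρ σ)) (sym (any-const _ (allFin (length w))))
eval-vacuous-ex {k = suc k} φ w ρ σ = sym (any-const-nonnull _ (allFin-nonnull (ρ fz)))

pruneEx : Form L (suc k) j → Form L k j
pruneEx ψ with x₀-occ ψ ℕ.≟ 0
... | yes x₀∉ψ = vacuous-ex _ (strengthen-x₀ ψ x₀∉ψ)
... | no  _    = ex ψ

pruneExS : Form mso k (suc j) → Form mso k j
pruneExS ψ with U₀-occ ψ ℕ.≟ 0
... | yes U₀∉ψ = strengthen-U₀ ψ U₀∉ψ
... | no  _    = exS ψ

prune : Form L k j → Form L k j
prune (lt x y)   = lt x y
prune (eq x y)   = eq x y
prune (Pl x)     = Pl x
prune (Pr x)     = Pr x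
prune (mem U x)  = mem U x
prune (neg φ)    = neg (prune φ)
prune (conj φ ψ) = conj (prune φ) (prune ψ)
prune (disj φ ψ) = disj (prune φ) (prune ψ)
prune (ex φ)     = pruneEx (prune φ)
prune (all′ φ)   = neg (pruneEx (neg (prune φ)))
prune (exS φ)    = pruneExS (prune φ)
prune (allS φ)   = neg (pruneExS (neg (prune φ)))

pruneEx-correct : (ψ : Form L (suc k) j) → ex ψ ≅ pruneEx ψ
pruneEx-correct ψ w ρ σ with x₀-occ ψ ℕ.≟ 0
... | yes x₀∉ψ = trans
  (any-cong (allFin (length w)) λ p → sym (eval-rename ψ x₀∉ψ unshift keep (unshift-agree p ρ) (keep-agree σ)))
  (sym (eval-vacuous-ex (strengthen-x₀ ψ x₀∉ψ) w ρ σ))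
... | no  _    = refl

pruneExS-correct : (ψ : Form mso k (suc j)) → exS ψ ≅ pruneExS ψ
pruneExS-correct ψ w ρ σ with U₀-occ ψ ℕ.≟ 0
... | yes U₀∉ψ = trans
  (any-cong (subsets (length w)) λ U → sym (eval-rename ψ U₀∉ψ keep unshift (keep-agree ρ) (unshift-agree U σ)))
  (any-const-nonnull _ (subsets-nonnull (length w)))
... | no  _    = refl

prune-correct : (φ : Form L k j) → φ ≅ prune φ
prune-correct (lt x y)   w ρ σ = refl
prune-correct (eq x y)   w ρ σ = refl
prune-correct (Pl x)     w ρ σ = refl
prune-correct (Pr x)     w ρ σ = refl
prune-correct (mem U x)  w ρ σ = refl
prune-correct (neg φ)    w ρ σ = cong not (prune-correct φ w ρ σ)
prune-correct (conj φ ψ) w ρ σ = cong₂ _∧_ (prune-correct φ w ρ σ) (prune-correct ψ w ρ σ)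
prune-correct (disj φ ψ) w ρ σ = cong₂ _∨_ (prune-correct φ w ρ σ) (prune-correct ψ w ρ σ)
prune-correct (ex φ)     w ρ σ =
  trans (any-cong (allFin (length w)) λ p → prune-correct φ w (p ∷ᶠ ρ) σ) (pruneEx-correct (prune φ) w ρ σ)
prune-correct (all′ φ)   w ρ σ = begin
  all (λ p → eval φ w (p ∷ᶠ ρ) σ) xs               ≡⟨ all-cong xs (λ p → prune-correct φ w (p ∷ᶠ ρ) σ) ⟩
  all (λ p → eval (prune φ) w (p ∷ᶠ ρ) σ) xs       ≡⟨ all≡not-any-not _ xs ⟩
  not (eval (ex (neg (prune φ))) w ρ σ)            ≡⟨ cong not (pruneEx-correct (neg (prune φ)) w ρ σ) ⟩
  not (eval (pruneEx (neg (prune φ))) w ρ σ)       ∎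
  where open ≡-Reasoning
        xs = allFin (length w)
prune-correct (exS φ)    w ρ σ =
  trans (any-cong (subsets (length w)) λ U → prune-correct φ w ρ (U ∷ᶠ σ)) (pruneExS-correct (prune φ) w ρ σ)
prune-correct (allS φ)   w ρ σ = begin
  all (λ U → eval φ w ρ (U ∷ᶠ σ)) Us               ≡⟨ all-cong Us (λ U → prune-correct φ w ρ (U ∷ᶠ σ)) ⟩
  all (λ U → eval (prune φ) w ρ (U ∷ᶠ σ)) Us       ≡⟨ all≡not-any-not _ Us ⟩
  not (eval (exS (neg (prune φ))) w ρ σ)           ≡⟨ cong not (pruneExS-correct (neg (prune φ)) w ρ σ) ⟩
  not (eval (pruneExS (neg (prune φ))) w ρ σ)      ∎
  where open ≡-Reasoning
        Us = subsets (length w)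

Bounded : ℕ → Form L k j → Set
Bounded s ψ = 2 * qr ψ + freeOcc ψ ≤ suc s

Bounded-mono : (ψ : Form L k j) (ψ′ : Form L k′ j′) → qr ψ′ ≡ qr ψ → freeOcc ψ′ ≤ freeOcc ψ →
               Bounded s ψ → Bounded s ψ′
Bounded-mono ψ ψ′ qr≡ occ≤ h = ≤-trans (subst (λ q → 2 * q + _ ≤ _) (sym qr≡) (+-monoʳ-≤ (2 * qr ψ) occ≤)) h

freeOcc-strengthen-x₀ : (ψ : Form L (suc k) j) (x₀∉ψ : x₀-occ ψ ≡ 0) → freeOcc (strengthen-x₀ ψ x₀∉ψ) ≤ freeOcc ψ
freeOcc-strengthen-x₀ ψ x₀∉ψ = begin
  freeOcc (strengthen-x₀ ψ x₀∉ψ)                ≡⟨ occ-rename ψ x₀∉ψ unshift keep (unshift-agree 0 (const 1)) (keep-agree _) ⟩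
  occ ψ (0 ∷ᶠ const 1) (const 1)               ≤⟨ m≤m+n _ (x₀-occ ψ) ⟩
  occ ψ (0 ∷ᶠ const 1) (const 1) + x₀-occ ψ   ≡⟨ freeOcc-split-x₀ ψ ⟨
  freeOcc ψ                                    ∎
  where open ≤-Reasoning

freeOcc-strengthen-U₀ : (ψ : Form mso k (suc j)) (U₀∉ψ : U₀-occ ψ ≡ 0) → freeOcc (strengthen-U₀ ψ U₀∉ψ) ≤ freeOcc ψ
freeOcc-strengthen-U₀ ψ U₀∉ψ = begin
  freeOcc (strengthen-U₀ ψ U₀∉ψ)               ≡⟨ occ-rename ψ U₀∉ψ keep unshift (keep-agree _) (unshift-agree 0 (const 1)) ⟩
  occ ψ (const 1) (0 ∷ᶠ const 1)               ≤⟨ m≤m+n _ (U₀-occ ψ) ⟩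
  occ ψ (const 1) (0 ∷ᶠ const 1) + U₀-occ ψ   ≡⟨ freeOcc-split-U₀ ψ ⟨
  freeOcc ψ                                    ∎
  where open ≤-Reasoning

-- Every atom mentions a first-order variable.
0<qr : (φ : Form L 0 j) → 0 < qr φ
0<qr (lt () _)
0<qr (eq () _)
0<qr (Pl ())
0<qr (Pr ())
0<qr (mem _ ())
0<qr (neg φ)    = 0<qr φ
0<qr (conj φ ψ) = ≤-trans (0<qr φ) (m≤m⊔n (qr φ) (qr ψ))
0<qr (disj φ ψ) = ≤-trans (0<qr φ) (m≤m⊔n (qr φ) (qr ψ))
0<qr (ex _)     = s≤s z≤n
0<qr (all′ _)   = s≤s z≤n
0<qr (exS _)    = s≤s z≤n
0<qr (allS _)   = s≤s z≤n

vacuous-ex-bound : (φ : Form L k j) → Bounded s φ → Bounded s (vacuous-ex k φ)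
vacuous-ex-bound {k = zero}  φ h rewrite m≥n⇒m⊔n≡m (0<qr φ) | +-identityʳ (freeOcc φ) = h
vacuous-ex-bound {k = suc k} φ h = h

bind-bound : ∀ q o x {s} → x ≢ 0 → 2 * q + (o + x) ≤ suc s → 2 * suc q + o ≤ suc (suc s)
bind-bound q o zero    x≢0 _ = contradiction refl x≢0
bind-bound q o (suc x) {s} _ h = begin
  2 * suc q + o             ≡⟨ cong (_+ o) (*-suc 2 q) ⟩
  suc (suc (2 * q + o))     ≤⟨ s≤s (s≤s (m≤m+n _ x)) ⟩
  suc (suc (2 * q + o + x)) ≡⟨ cong suc (reassoc q o x) ⟨
  suc (2 * q + (o + suc x)) ≤⟨ s≤s h ⟩
  suc (suc s)               ∎
  where
  open ≤-Reasoning
  reassoc : ∀ q o x → 2 * q + (o + suc x) ≡ suc (2 * q + o + x)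
  reassoc = solve-∀

⊔-bound : ∀ a b x y {s t} → 2 * a + x ≤ suc s → 2 * b + y ≤ suc t → 2 * (a ⊔ b) + (x + y) ≤ suc (s + t + 1)
⊔-bound a b x y {s} {t} ha hb = begin
  2 * (a ⊔ b) + (x + y)     ≤⟨ +-monoˡ-≤ (x + y) (*-monoʳ-≤ 2 (m⊔n≤m+n a b)) ⟩
  2 * (a + b) + (x + y)     ≡⟨ regroup a b x y ⟩
  (2 * a + x) + (2 * b + y) ≤⟨ +-mono-≤ ha hb ⟩
  suc s + suc t             ≡⟨ cong suc (+-suc s t) ⟩
  suc (suc (s + t))         ≡⟨ cong suc (+-comm 1 (s + t)) ⟩
  suc (s + t + 1)           ∎
  where
  open ≤-Reasoning
  regroup : ∀ a b x y → 2 * (a + b) + (x + y) ≡ (2 * a + x) + (2 * b + y)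
  regroup = solve-∀

pruneEx-bound : (ψ : Form L (suc k) j) → Bounded s ψ → Bounded (suc s) (pruneEx ψ)
pruneEx-bound {s = s} ψ h with x₀-occ ψ ℕ.≟ 0
... | yes x₀∉ψ = m≤n⇒m≤1+n (vacuous-ex-bound (strengthen-x₀ ψ x₀∉ψ)
  (Bounded-mono ψ (strengthen-x₀ ψ x₀∉ψ) (qr-rename ψ x₀∉ψ unshift keep) (freeOcc-strengthen-x₀ ψ x₀∉ψ) h))
... | no  x₀∈ψ = bind-bound (qr ψ) _ _ x₀∈ψ (subst (λ o → 2 * qr ψ + o ≤ suc s) (freeOcc-split-x₀ ψ) h)

pruneExS-bound : (ψ : Form mso k (suc j)) → Bounded s ψ → Bounded (suc s) (pruneExS ψ)
pruneExS-bound {s = s} ψ h with U₀-occ ψ ℕ.≟ 0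
... | yes U₀∉ψ = m≤n⇒m≤1+n
  (Bounded-mono ψ (strengthen-U₀ ψ U₀∉ψ) (qr-rename ψ U₀∉ψ keep unshift) (freeOcc-strengthen-U₀ ψ U₀∉ψ) h)
... | no  U₀∈ψ = bind-bound (qr ψ) _ _ U₀∈ψ (subst (λ o → 2 * qr ψ + o ≤ suc s) (freeOcc-split-U₀ ψ) h)

prune-bound : (φ : Form L k j) → Bounded (sz φ) (prune φ)
prune-bound (lt x y)   = ≤-refl
prune-bound (eq x y)   = ≤-refl
prune-bound (Pl x)     = n≤1+n 1
prune-bound (Pr x)     = n≤1+n 1
prune-bound (mem U x)  = ≤-refl
prune-bound (neg φ)    = m≤n⇒m≤1+n (prune-bound φ)
prune-bound (conj φ ψ) = ⊔-bound (qr (prune φ)) (qr (prune ψ)) _ _ (prune-bound φ) (prune-bound ψ)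
prune-bound (disj φ ψ) = ⊔-bound (qr (prune φ)) (qr (prune ψ)) _ _ (prune-bound φ) (prune-bound ψ)
prune-bound (ex φ)     = pruneEx-bound (prune φ) (prune-bound φ)
prune-bound (all′ φ)   = pruneEx-bound (neg (prune φ)) (prune-bound φ)
prune-bound (exS φ)    = pruneExS-bound (prune φ) (prune-bound φ)
prune-bound (allS φ)   = pruneExS-bound (neg (prune φ)) (prune-bound φ)

prune-qr : (φ : Form L k j) → sz φ ≤ 2 * n → qr (prune φ) ≤ n
prune-qr {n = n} φ sz≤2n = s≤s⁻¹ (*-cancelˡ-< 2 _ _ (begin-strict
  2 * qr (prune φ)                     ≤⟨ m≤m+n _ _ ⟩
  2 * qr (prune φ) + freeOcc (prune φ) ≤⟨ prune-bound φ ⟩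
  suc (sz φ)                           ≤⟨ s≤s sz≤2n ⟩
  suc (2 * n)                          <⟨ n<1+n _ ⟩
  2 + 2 * n                            ≡⟨ *-suc 2 n ⟨
  2 * suc n                            ∎))
  where open ≤-Reasoning

lemma1 : (n : ℕ) →
    ((k : ℕ) (φ : Form fo k 0) → sz φ ≤ 2 * n → Σ[ ψ ∈ Form fo k 0 ] (qr ψ ≤ n × φ ≅ ψ))
    × ((k j : ℕ) (φ : Form mso k j) → sz φ ≤ 2 * n → Σ[ ψ ∈ Form mso k j ] (qr ψ ≤ n × φ ≅ ψ))
lemma1 n = (λ k → rank-reduction) , (λ k j → rank-reduction)
  where
  rank-reduction : (φ : Form L k j) → sz φ ≤ 2 * n → Σ[ ψ ∈ Form L k j ] (qr ψ ≤ n × φ ≅ ψ)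
  rank-reduction φ sz≤2n = prune φ , prune-qr φ sz≤2n , prune-correct φ
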